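{- Let $X=X_1\sqcup X_2$ carry a coherent configuration $\{\sigma_1,\dots,\sigma_{10}\}$ of type $[3\ 2;\ 3]$ with parameters as in the context. Then (6) $N_1^2+P_1(k_1-N_1)=k_1+\lambda_1N_1+\mu_1(S_1-N_1-1)$; (7) $N_1P_1+P_1(k_1-P_1)=\lambda_1P_1+\mu_1(S_1-P_1)$; (8) $N_1a_2+P_1(S_2-a_2)=S_2+a_2\lambda_1+b_2(k_1-\lambda_1-1)$; (9) $N_1b_2+P_1(S_2-b_2)=a_2\mu_1+b_2(k_1-\mu_1)$; (10) $S_1+a_1N_2+b_1(S_2-N_2-1)=S_2+a_2N_1+b_2(S_1-N_1-1)$; (11) $a_1P_2+b_1(S_2-P_2)=a_2P_1+b_2(S_1-P_1)$; (12) $P_1(k_2-N_2)=P_2(k_1-N_1)$.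
   Context: A coherent configuration on a finite set $X$ is a partition of $X\times X$ into nonempty relations $\sigma_1,\dots,\sigma_m$ such that the diagonal is a union of some $\sigma_i$, the transpose of each $\sigma_i$ is some $\sigma_{i^*}$, and for all $i,j,k$ and $(x,z)\in\sigma_k$ the number $|\{y:(x,y)\in\sigma_i,(y,z)\in\sigma_j\}|$ depends only on $i,j,k$. Type $[3\ 2;\ 3]$ means: $X=X_1\sqcup X_2$, $|X_i|=n_i$; $\sigma_1$ is the identity on $X_1$, $\sigma_2,\sigma_3$ are symmetric relations partitioning the off-diagonal pairs of $X_1\times X_1$, with $\sigma_2$ a strongly regular graph with parameters $(n_1,k_1,\lambda_1,\mu_1)$ and $\sigma_3$ its complement; $\sigma_4$ is the identity on $X_2$, $\sigma_5$ is a strongly regular graph on $X_2$ with parameters $(n_2,k_2,\lambda_2,\mu_2)$, $\sigma_6$ its complement; $\sigma_7,\sigma_8$ partition $X_1\times X_2$, $\sigma_9=\sigma_7^T$, $\sigma_{10}=\sigma_8^T$. $S_2$ = number of $z\in X_2$ with $(x,z)\in\sigma_7$ for $x\in X_1$; $S_1$ = number of $x\in X_1$ with $(x,z)\in\sigma_7$ for $z\in X_2$. For distinct $x,y\in X_1$, the number of $z\in X_2$ with $(x,z),(y,z)\in\sigma_7$ is $a_2$ if $(x,y)\in\sigma_2$ and $b_2$ if $(x,y)\in\sigma_3$. For distinct $z,w\in X_2$, the number of $x\in X_1$ with $(x,z),(x,w)\in\sigma_7$ is $a_1$ if $(z,w)\in\sigma_5$ and $b_1$ if $(z,w)\in\sigma_6$.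 For $x\in X_1,z\in X_2$: the number of $y\in X_1$ with $(x,y)\in\sigma_2$ and $(y,z)\in\sigma_7$ is $N_1$ if $(x,z)\in\sigma_7$ and $P_1$ if $(x,z)\in\sigma_8$; the number of $w\in X_2$ with $(x,w)\in\sigma_7$ and $(w,z)\in\sigma_5$ is $N_2$ if $(x,z)\in\sigma_7$ and $P_2$ if $(x,z)\in\sigma_8$. -}

module Defs where

open import Data.Nat using (ℕ; zero; suc)
open import Data.Bool using (Bool; true; false; not; _∧_; if_then_else_)
open import Data.Fin using (Fin; _≟_)
open import Data.List using (List; []; _∷_; map; _++_; allFin)
open import Data.Sum using (_⊎_; inj₁; inj₂)
open import Data.Product using (Σ; ∃; _×_)
open import Relation.Nullary using (¬_)
open import Relation.Nullary.Decidable using (⌊_⌋)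
open import Relation.Binary.PropositionalEquality using (_≡_)

count : {A : Set} → (A → Bool) → List A → ℕ
count p []       = zero
count p (a ∷ as) = if p a then suc (count p as) else count p as

-- Coherent configuration on a finite set X (enumerated without repetition
-- by `elems`), with relations indexed by a finite type I (enumerated by
-- `idxs`), each relation given as a Boolean-valued function on X × X.

record IsCoherentConfiguration {X I : Set} (elems : List X) (idxs : List I)
                               (σ : I → X → X → Bool) : Set where
  field
    partition : ∀ x y → count (λ i → σ i x y) idxs ≡ 1
    nonempty  : ∀ i → Σ X λ x → Σ X λ y → σ i x y ≡ true
    -- the diagonal is a union of some relations: each relation lies inside
    -- the diagonal or is disjoint from it
    diagonal  : ∀ i → (∀ x y → σ i x y ≡ true → x ≡ y)
                    ⊎ (∀ x y → σ i x y ≡ true → ¬ (x ≡ y))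
    transpose : ∀ i → Σ I λ j → ∀ x y → σ j x y ≡ σ i y x
    regular   : ∀ i j k → Σ ℕ λ p → ∀ x z → σ k x z ≡ true →
                  count (λ y → σ i x y ∧ σ j y z) elems ≡ p

data Idx : Set where
  s1 s2 s3 s4 s5 s6 s7 s8 s9 s10 : Idx

idxs : List Idx
idxs = s1 ∷ s2 ∷ s3 ∷ s4 ∷ s5 ∷ s6 ∷ s7 ∷ s8 ∷ s9 ∷ s10 ∷ []

X : ℕ → ℕ → Set
X n₁ n₂ = Fin n₁ ⊎ Fin n₂

elemsX : (n₁ n₂ : ℕ) → List (X n₁ n₂)
elemsX n₁ n₂ = map inj₁ (allFin n₁) ++ map inj₂ (allFin n₂)

eqb : {n : ℕ} → Fin n → Fin n → Bool
eqb x y = ⌊ x ≟ y ⌋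

-- σ built from: E₁ (graph σ₂ on X₁, diagonal ignored), E₂ (graph σ₅ on X₂,
-- diagonal ignored), R (relation σ₇ ⊆ X₁ × X₂).
σ : {n₁ n₂ : ℕ} → (Fin n₁ → Fin n₁ → Bool) → (Fin n₂ → Fin n₂ → Bool)
    → (Fin n₁ → Fin n₂ → Bool) → Idx → X n₁ n₂ → X n₁ n₂ → Bool
σ E₁ E₂ R s1  (inj₁ x) (inj₁ y) = eqb x y
σ E₁ E₂ R s2  (inj₁ x) (inj₁ y) = not (eqb x y) ∧ E₁ x y
σ E₁ E₂ R s3  (inj₁ x) (inj₁ y) = not (eqb x y) ∧ not (E₁ x y)
σ E₁ E₂ R s4  (inj₂ z) (inj₂ w) = eqb z w
σ E₁ E₂ R s5  (inj₂ z) (inj₂ w) = not (eqb z w) ∧ E₂ z w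
σ E₁ E₂ R s6  (inj₂ z) (inj₂ w) = not (eqb z w) ∧ not (E₂ z w)
σ E₁ E₂ R s7  (inj₁ x) (inj₂ z) = R x z
σ E₁ E₂ R s8  (inj₁ x) (inj₂ z) = not (R x z)
σ E₁ E₂ R s9  (inj₂ z) (inj₁ x) = R x z
σ E₁ E₂ R s10 (inj₂ z) (inj₁ x) = not (R x z)
σ E₁ E₂ R _   _        _        = false

record Params {n₁ n₂ : ℕ} (E₁ : Fin n₁ → Fin n₁ → Bool)
              (E₂ : Fin n₂ → Fin n₂ → Bool) (R : Fin n₁ → Fin n₂ → Bool) : Set where
  private
    s = σ E₁ E₂ R
    X₁ = map (inj₁ {B = Fin n₂}) (allFin n₁)
    X₂ = map (inj₂ {A = Fin n₁}) (allFin n₂)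
  field
    k₁ λ₁ μ₁ k₂ λ₂ μ₂ S₁ S₂ a₁ b₁ a₂ b₂ N₁ P₁ N₂ P₂ : ℕ
    k₁-def : ∀ x → count (λ y → s s2 (inj₁ x) y) X₁ ≡ k₁
    λ₁-def : ∀ x y → s s2 (inj₁ x) (inj₁ y) ≡ true →
               count (λ v → s s2 (inj₁ x) v ∧ s s2 v (inj₁ y)) X₁ ≡ λ₁
    μ₁-def : ∀ x y → s s3 (inj₁ x) (inj₁ y) ≡ true →
               count (λ v → s s2 (inj₁ x) v ∧ s s2 v (inj₁ y)) X₁ ≡ μ₁
    k₂-def : ∀ z → count (λ w → s s5 (inj₂ z) w) X₂ ≡ k₂
    λ₂-def : ∀ z w → s s5 (inj₂ z) (inj₂ w) ≡ true →
               count (λ v → s s5 (inj₂ z) v ∧ s s5 v (inj₂ w)) X₂ ≡ λ₂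
    μ₂-def : ∀ z w → s s6 (inj₂ z) (inj₂ w) ≡ true →
               count (λ v → s s5 (inj₂ z) v ∧ s s5 v (inj₂ w)) X₂ ≡ μ₂
    S₂-def : ∀ x → count (λ z → s s7 (inj₁ x) z) X₂ ≡ S₂
    S₁-def : ∀ z → count (λ x → s s7 x (inj₂ z)) X₁ ≡ S₁
    a₂-def : ∀ x y → s s2 (inj₁ x) (inj₁ y) ≡ true →
               count (λ z → s s7 (inj₁ x) z ∧ s s7 (inj₁ y) z) X₂ ≡ a₂
    b₂-def : ∀ x y → s s3 (inj₁ x) (inj₁ y) ≡ true →
               count (λ z → s s7 (inj₁ x) z ∧ s s7 (inj₁ y) z) X₂ ≡ b₂
    a₁-def : ∀ z w → s s5 (inj₂ z) (inj₂ w) ≡ true →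
               count (λ x → s s7 x (inj₂ z) ∧ s s7 x (inj₂ w)) X₁ ≡ a₁
    b₁-def : ∀ z w → s s6 (inj₂ z) (inj₂ w) ≡ true →
               count (λ x → s s7 x (inj₂ z) ∧ s s7 x (inj₂ w)) X₁ ≡ b₁
    N₁-def : ∀ x z → s s7 (inj₁ x) (inj₂ z) ≡ true →
               count (λ y → s s2 (inj₁ x) y ∧ s s7 y (inj₂ z)) X₁ ≡ N₁
    P₁-def : ∀ x z → s s8 (inj₁ x) (inj₂ z) ≡ true →
               count (λ y → s s2 (inj₁ x) y ∧ s s7 y (inj₂ z)) X₁ ≡ P₁
    N₂-def : ∀ x z → s s7 (inj₁ x) (inj₂ z) ≡ true →
               count (λ w → s s7 (inj₁ x) w ∧ s s5 w (inj₂ z)) X₂ ≡ N₂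
    P₂-def : ∀ x z → s s8 (inj₁ x) (inj₂ z) ≡ true →
               count (λ w → s s7 (inj₁ x) w ∧ s s5 w (inj₂ z)) X₂ ≡ P₂

-- The seven identities (6)–(12), stated in ℤ (subtraction is integer
-- subtraction, no truncation).

open import Data.Integer as Int using (ℤ; +_)

Identities : {n₁ n₂ : ℕ} {E₁ : Fin n₁ → Fin n₁ → Bool} {E₂ : Fin n₂ → Fin n₂ → Bool}
             {R : Fin n₁ → Fin n₂ → Bool} → Params E₁ E₂ R → Set
Identities p =
       (n1 * n1 + p1 * (k1 - n1) ≡ k1 + l1 * n1 + m1 * (S1 - n1 - + 1))
     × (n1 * p1 + p1 * (k1 - p1) ≡ l1 * p1 + m1 * (S1 - p1))
     × (n1 * A2 + p1 * (S2 - A2) ≡ S2 + A2 * l1 + B2 * (k1 - l1 - + 1))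
     × (n1 * B2 + p1 * (S2 - B2) ≡ A2 * m1 + B2 * (k1 - m1))
     × (S1 + A1 * n2 + B1 * (S2 - n2 - + 1) ≡ S2 + A2 * n1 + B2 * (S1 - n1 - + 1))
     × (A1 * p2 + B1 * (S2 - p2) ≡ A2 * p1 + B2 * (S1 - p1))
     × (p1 * (k2 - n2) ≡ p2 * (k1 - n1))
  where
  open Params p
  open Int using (_+_; _*_; _-_)
  k1 = + k₁
  l1 = + λ₁
  m1 = + μ₁
  k2 = + k₂
  S1 = + S₁
  S2 = + S₂
  A1 = + a₁
  B1 = + b₁
  A2 = + a₂
  B2 = + b₂
  n1 = + N₁
  p1 = + P₁
  n2 = + N₂
  p2 = + P₂

-- Each identity is a double count.  Fix two points and count the paths of length three
-- between them whose steps lie in prescribed relations, once grouped by the second vertex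
-- and once by the third.  The inner counts are intersection numbers (N₁, P₁, λ₁, a₂, ...),
-- and the counts that are not parameters are eliminated by splitting the valencies k₁, k₂,
-- S₁, S₂ along the same relations.  Paths σ₂σ₂σ₇ give (6) and (7), σ₂σ₇σ₉ give (8) and (9),
-- σ₇σ₉σ₇ give (10) and (11), and σ₂σ₇σ₅ give (12); the two identities of a pair come from
-- endpoints in σ₇ or σ₈ (in σ₂ or σ₃).

module Submission where

open import Data.Bool using (Bool; true; false; not; _∧_; if_then_else_)
open import Data.Bool.Properties
  using (∧-assoc; ∧-comm; ∧-idem; ∧-zeroʳ; ∧-conicalˡ; ∧-conicalʳ; not-injective)
open import Data.Fin using (Fin; _≟_) renaming (zero to fzero; suc to fsuc)
open import Data.Fin.Properties using (suc-injective)
open import Data.Integer.Base using (ℤ; +_)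
import Data.Integer.Base as ℤ
open import Data.Integer.Properties using (pos-+; pos-*)
open import Data.List using (List; []; _∷_; map; tabulate; allFin)
open import Data.List.Properties using (map-tabulate)
open import Data.Nat.Base using (ℕ; suc)
import Data.Nat.Base as ℕ
open import Data.Product using (Σ; ∃₂; _×_; _,_)
open import Data.Sum using (inj₁; inj₂)
open import Function using (id)
open import Relation.Binary.PropositionalEquality
open import Relation.Nullary using (yes; no; contradiction)
open import Relation.Nullary.Decidable using (⌊⌋-map′)

open import Defs

module Counting where

  open import Data.Nat.Base using (_+_; _*_)
  open import Data.Nat.Properties
    using (+-identityʳ; +-suc; +-assoc; *-suc; *-zeroʳ; +-commutativeSemigroup)
  open import Algebra.Properties.CommutativeSemigroup +-commutativeSemigroup
    using (interchange)

  private variable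
    A B : Set

  infix 8 ⟦_⟧·_

  ⟦_⟧·_ : Bool → ℕ → ℕ
  ⟦ b ⟧· n = if b then n else 0

  ∑ : (A → ℕ) → List A → ℕ
  ∑ f []       = 0
  ∑ f (a ∷ as) = f a + ∑ f as

  count-cong : {p q : A → Bool} → (∀ a → p a ≡ q a) → ∀ xs → count p xs ≡ count q xs
  count-cong         eq []       = refl
  count-cong {q = q} eq (a ∷ xs) rewrite eq a =
    cong (λ n → if q a then suc n else n) (count-cong eq xs)

  count-∧-comm : (p q : A → Bool) (xs : List A) →
                 count (λ a → p a ∧ q a) xs ≡ count (λ a → q a ∧ p a) xs
  count-∧-comm p q = count-cong (λ a → ∧-comm (p a) (q a))

  count-map : (p : B → Bool) (f : A → B) (xs : List A) →
              count (λ a → p (f a)) xs ≡ count p (map f xs)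
  count-map p f []       = refl
  count-map p f (a ∷ xs) = cong (λ n → if p (f a) then suc n else n) (count-map p f xs)

  count-none : (xs : List A) → count (λ _ → false) xs ≡ 0
  count-none []       = refl
  count-none (_ ∷ xs) = count-none xs

  count-guard : ∀ b (p : A → Bool) (xs : List A) → count (λ a → b ∧ p a) xs ≡ ⟦ b ⟧· count p xs
  count-guard true  p xs = refl
  count-guard false p xs = count-none xs

  count≡∑ : (p : A → Bool) (xs : List A) → count p xs ≡ ∑ (λ a → ⟦ p a ⟧· 1) xs
  count≡∑ p []       = refl
  count≡∑ p (a ∷ xs) with p a
  ... | true  = cong suc (count≡∑ p xs)
  ... | false = count≡∑ p xs

  count-split : (p q : A → Bool) (xs : List A) →
                count p xs ≡ count (λ a → p a ∧ q a) xs + count (λ a → p a ∧ not (q a)) xs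
  count-split p q []       = refl
  count-split p q (a ∷ xs) with p a | q a
  ... | true  | true  = cong suc (count-split p q xs)
  ... | true  | false = trans (cong suc (count-split p q xs)) (sym (+-suc _ _))
  ... | false | _     = count-split p q xs

  count-split₃ : (p b c : A → Bool) (xs : List A) →
                 count p xs ≡ count (λ a → p a ∧ b a) xs
                            + count (λ a → p a ∧ (not (b a) ∧ c a)) xs
                            + count (λ a → p a ∧ (not (b a) ∧ not (c a))) xs
  count-split₃ {A = A} p b c xs = begin
    count p xs
      ≡⟨ count-split p b xs ⟩
    count pb xs + count (λ a → p a ∧ not (b a)) xs
      ≡⟨ cong (_+_ (count pb xs)) (count-split _ c xs) ⟩
    count pb xs + (count (λ a → (p a ∧ not (b a)) ∧ c a) xs
                   + count (λ a → (p a ∧ not (b a)) ∧ not (c a)) xs)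
      ≡⟨ +-assoc (count pb xs) _ _ ⟨
    count pb xs + count (λ a → (p a ∧ not (b a)) ∧ c a) xs
                + count (λ a → (p a ∧ not (b a)) ∧ not (c a)) xs
      ≡⟨ cong₂ (λ s t → count pb xs + s + t)
               (count-cong (λ a → ∧-assoc (p a) (not (b a)) (c a)) xs)
               (count-cong (λ a → ∧-assoc (p a) (not (b a)) (not (c a))) xs) ⟩
    count pb xs + count (λ a → p a ∧ (not (b a) ∧ c a)) xs
                + count (λ a → p a ∧ (not (b a) ∧ not (c a))) xs ∎
    where
    open ≡-Reasoning
    pb : A → Bool
    pb a = p a ∧ b a

  ∑-cong : {f g : A → ℕ} → (∀ a → f a ≡ g a) → ∀ xs → ∑ f xs ≡ ∑ g xs
  ∑-cong eq []       = refl
  ∑-cong eq (a ∷ xs) = cong₂ _+_ (eq a) (∑-cong eq xs)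

  ∑-+ : (f g : A → ℕ) (xs : List A) → ∑ (λ a → f a + g a) xs ≡ ∑ f xs + ∑ g xs
  ∑-+ f g []       = refl
  ∑-+ f g (a ∷ xs) =
    trans (cong (_+_ (f a + g a)) (∑-+ f g xs)) (interchange (f a) (g a) (∑ f xs) (∑ g xs))

  ∑-zero : (xs : List A) → ∑ (λ _ → 0) xs ≡ 0
  ∑-zero []       = refl
  ∑-zero (_ ∷ xs) = ∑-zero xs

  ∑-comm : (F : A → B → ℕ) (xs : List A) (ys : List B) →
           ∑ (λ a → ∑ (F a) ys) xs ≡ ∑ (λ b → ∑ (λ a → F a b) xs) ys
  ∑-comm F []       ys = sym (∑-zero ys)
  ∑-comm F (a ∷ xs) ys =
    trans (cong (_+_ (∑ (F a) ys)) (∑-comm F xs ys)) (sym (∑-+ (F a) _ ys))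

  ∑-⟦⟧· : (p : A → Bool) (c : ℕ) (xs : List A) → ∑ (λ a → ⟦ p a ⟧· c) xs ≡ c * count p xs
  ∑-⟦⟧· p c []       = sym (*-zeroʳ c)
  ∑-⟦⟧· p c (a ∷ xs) with p a
  ... | true  = trans (cong (_+_ c) (∑-⟦⟧· p c xs)) (sym (*-suc c _))
  ... | false = ∑-⟦⟧· p c xs

  -- Both sides count the pairs (a , b) with f a ∧ m a b ∧ g b.
  count-paths : (f : A → Bool) (g : B → Bool) (xs : List A) (ys : List B)
                {m : A → B → Bool} {u : A → ℕ} {w : B → ℕ} →
                (∀ a → count (λ b → m a b ∧ g b) ys ≡ u a) →
                (∀ b → count (λ a → f a ∧ m a b) xs ≡ w b) →
                ∑ (λ a → ⟦ f a ⟧· u a) xs ≡ ∑ (λ b → ⟦ g b ⟧· w b) ys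
  count-paths f g xs ys {m} {u} {w} hu hw = begin
    ∑ (λ a → ⟦ f a ⟧· u a) xs
      ≡⟨ ∑-cong (λ a → cong (⟦ f a ⟧·_) (hu a)) xs ⟨
    ∑ (λ a → ⟦ f a ⟧· count (λ b → m a b ∧ g b) ys) xs
      ≡⟨ ∑-cong (λ a → guarded (f a) _ ys) xs ⟩
    ∑ (λ a → ∑ (λ b → ⟦ f a ∧ (m a b ∧ g b) ⟧· 1) ys) xs
      ≡⟨ ∑-comm _ xs ys ⟩
    ∑ (λ b → ∑ (λ a → ⟦ f a ∧ (m a b ∧ g b) ⟧· 1) xs) ys
      ≡⟨ ∑-cong (λ b → ∑-cong (λ a → cong (⟦_⟧· 1) (rotate (f a) (m a b) (g b))) xs) ys ⟩
    ∑ (λ b → ∑ (λ a → ⟦ g b ∧ (f a ∧ m a b) ⟧· 1) xs) ys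
      ≡⟨ ∑-cong (λ b → guarded (g b) _ xs) ys ⟨
    ∑ (λ b → ⟦ g b ⟧· count (λ a → f a ∧ m a b) xs) ys
      ≡⟨ ∑-cong (λ b → cong (⟦ g b ⟧·_) (hw b)) ys ⟩
    ∑ (λ b → ⟦ g b ⟧· w b) ys ∎
    where
    open ≡-Reasoning
    guarded : {C : Set} (c : Bool) (p : C → Bool) (zs : List C) →
              ⟦ c ⟧· count p zs ≡ ∑ (λ a → ⟦ c ∧ p a ⟧· 1) zs
    guarded c p zs = trans (sym (count-guard c p zs)) (count≡∑ _ zs)
    rotate : ∀ a b c → a ∧ (b ∧ c) ≡ c ∧ (a ∧ b)
    rotate a b c = trans (sym (∧-assoc a b c)) (∧-comm (a ∧ b) c)

  ∑-guarded₂ : (f p : A → Bool) (m n : ℕ) (xs : List A) →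
               ∑ (λ a → ⟦ f a ⟧· (if p a then m else n)) xs
               ≡ m * count (λ a → f a ∧ p a) xs + n * count (λ a → f a ∧ not (p a)) xs
  ∑-guarded₂ f p m n xs = begin
    ∑ (λ a → ⟦ f a ⟧· (if p a then m else n)) xs
      ≡⟨ ∑-cong (λ a → split (f a) (p a)) xs ⟩
    ∑ (λ a → ⟦ f a ∧ p a ⟧· m + ⟦ f a ∧ not (p a) ⟧· n) xs
      ≡⟨ ∑-+ _ _ xs ⟩
    ∑ (λ a → ⟦ f a ∧ p a ⟧· m) xs + ∑ (λ a → ⟦ f a ∧ not (p a) ⟧· n) xs
      ≡⟨ cong₂ _+_ (∑-⟦⟧· _ m xs) (∑-⟦⟧· _ n xs) ⟩
    m * count (λ a → f a ∧ p a) xs + n * count (λ a → f a ∧ not (p a)) xs ∎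
    where
    open ≡-Reasoning
    split : ∀ a b → ⟦ a ⟧· (if b then m else n) ≡ ⟦ a ∧ b ⟧· m + ⟦ a ∧ not b ⟧· n
    split false b     = refl
    split true  true  = sym (+-identityʳ m)
    split true  false = refl

  ∑-guarded₃ : (f b c : A → Bool) (α β γ : ℕ) (xs : List A) →
               ∑ (λ a → ⟦ f a ⟧· (if b a then α else if c a then β else γ)) xs
               ≡ α * count (λ a → f a ∧ b a) xs
               + β * count (λ a → f a ∧ (not (b a) ∧ c a)) xs
               + γ * count (λ a → f a ∧ (not (b a) ∧ not (c a))) xs
  ∑-guarded₃ f b c α β γ xs = begin
    ∑ (λ a → ⟦ f a ⟧· (if b a then α else if c a then β else γ)) xs
      ≡⟨ ∑-cong (λ a → split (f a) (b a) (c a)) xs ⟩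
    ∑ (λ a → ⟦ f a ∧ b a ⟧· α + ⟦ f a ∧ (not (b a) ∧ c a) ⟧· β
             + ⟦ f a ∧ (not (b a) ∧ not (c a)) ⟧· γ) xs
      ≡⟨ ∑-+ _ _ xs ⟩
    _ ≡⟨ cong (_+ _) (∑-+ _ _ xs) ⟩
    _ ≡⟨ cong₂ _+_ (cong₂ _+_ (∑-⟦⟧· _ α xs) (∑-⟦⟧· _ β xs)) (∑-⟦⟧· _ γ xs) ⟩
    _ ∎
    where
    open ≡-Reasoning
    split : ∀ a b c → ⟦ a ⟧· (if b then α else if c then β else γ)
                      ≡ ⟦ a ∧ b ⟧· α + ⟦ a ∧ (not b ∧ c) ⟧· β + ⟦ a ∧ (not b ∧ not c) ⟧· γ
    split false b     c     = refl
    split true  true  c     = sym (trans (+-identityʳ (α + 0)) (+-identityʳ α))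
    split true  false true  = sym (+-identityʳ β)
    split true  false false = refl

open Counting

eqb⇒≡ : ∀ {n} {x y : Fin n} → eqb x y ≡ true → x ≡ y
eqb⇒≡ {x = x} {y} h with x ≟ y
... | yes x≡y = x≡y
... | no _    = contradiction h λ ()

eqb-sym : ∀ {n} (x y : Fin n) → eqb x y ≡ eqb y x
eqb-sym x y with x ≟ y | y ≟ x
... | yes _   | yes _   = refl
... | no _    | no _    = refl
... | yes x≡y | no y≢x = contradiction (sym x≡y) y≢x
... | no x≢y | yes y≡x = contradiction (sym y≡x) x≢y

eqb-suc : ∀ {n} (x y : Fin n) → eqb (fsuc x) (fsuc y) ≡ eqb x y
eqb-suc x y = ⌊⌋-map′ (cong fsuc) suc-injective (x ≟ y)

count-tabulate : ∀ {n} {A : Set} (p : A → Bool) (f : Fin n → A) →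
                 count p (tabulate f) ≡ count (λ i → p (f i)) (allFin n)
count-tabulate {n} p f = trans (cong (count p) (sym (map-tabulate id f))) (sym (count-map p f (allFin n)))

count-eqb : ∀ {n} (x : Fin n) → count (eqb x) (allFin n) ≡ 1
count-eqb {suc n} fzero    = cong suc (trans (count-tabulate {n} (eqb fzero) fsuc) (count-none (allFin n)))
count-eqb {suc n} (fsuc x) = begin
  count (eqb (fsuc x)) (tabulate fsuc)          ≡⟨ count-tabulate {n} (eqb (fsuc x)) fsuc ⟩
  count (λ i → eqb (fsuc x) (fsuc i)) (allFin n) ≡⟨ count-cong (eqb-suc x) (allFin n) ⟩
  count (eqb x) (allFin n)                       ≡⟨ count-eqb x ⟩
  1                                              ∎
  where open ≡-Reasoning

count-at : ∀ {n} (q : Fin n → Bool) (x : Fin n) →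
           count (λ v → q v ∧ eqb x v) (allFin n) ≡ ⟦ q x ⟧· 1
count-at {n} q x = begin
  count (λ v → q v ∧ eqb x v) (allFin n) ≡⟨ count-cong at-x (allFin n) ⟩
  count (λ v → q x ∧ eqb x v) (allFin n) ≡⟨ count-guard (q x) (eqb x) (allFin n) ⟩
  ⟦ q x ⟧· count (eqb x) (allFin n)      ≡⟨ cong (⟦ q x ⟧·_) (count-eqb x) ⟩
  ⟦ q x ⟧· 1                              ∎
  where
  open ≡-Reasoning
  at-x : ∀ v → (q v ∧ eqb x v) ≡ (q x ∧ eqb x v)
  at-x v with eqb x v in e
  ... | true  = cong (λ u → q u ∧ true) (sym (eqb⇒≡ e))
  ... | false = trans (∧-zeroʳ (q v)) (sym (∧-zeroʳ (q x)))

count-at′ : ∀ {n} (q : Fin n → Bool) (x : Fin n) →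
            count (λ v → q v ∧ eqb v x) (allFin n) ≡ ⟦ q x ⟧· 1
count-at′ {n} q x = trans (count-cong (λ v → cong (q v ∧_) (eqb-sym v x)) (allFin n)) (count-at q x)

adjacency-sym : ∀ {n} {E : Fin n → Fin n → Bool} → (∀ x y → E x y ≡ E y x) →
                ∀ x y → not (eqb x y) ∧ E x y ≡ not (eqb y x) ∧ E y x
adjacency-sym E-sym x y = cong₂ (λ a b → not a ∧ b) (eqb-sym x y) (E-sym x y)

by-adjacency : ∀ {n} (E : Fin n → Fin n → Bool) {f : Fin n → Fin n → ℕ} {α β γ : ℕ} →
               (∀ x → f x x ≡ α) →
               (∀ x y → not (eqb x y) ∧ E x y ≡ true → f x y ≡ β) →
               (∀ x y → not (eqb x y) ∧ not (E x y) ≡ true → f x y ≡ γ) →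
               ∀ x y → f x y ≡ (if eqb x y then α else if E x y then β else γ)
by-adjacency E diag edge non-edge x y with eqb x y in e | E x y in e′
... | true  | _     rewrite eqb⇒≡ e = diag y
... | false | true  = edge x y (cong₂ (λ a b → not a ∧ b) e e′)
... | false | false = non-edge x y (cong₂ (λ a b → not a ∧ not b) e e′)

module IntegerIdentities where

  open import Data.Integer.Base using (_+_; _*_; _-_)
  open import Data.Integer.Tactic.RingSolver using (solve)
  open ≡-Reasoning

  lift-≡ : ∀ {a b : ℕ} {i j : ℤ} → + a ≡ i → + b ≡ j → a ≡ b → i ≡ j
  lift-≡ a≡i b≡j refl = trans (sym a≡i) b≡j

  pos-+₃ : ∀ a b c → + (a ℕ.+ b ℕ.+ c) ≡ + a + + b + + c
  pos-+₃ a b c = trans (pos-+ (a ℕ.+ b) c) (cong (_+ + c) (pos-+ a b))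

  pos-linear₂ : ∀ a b c d → + (a ℕ.* b ℕ.+ c ℕ.* d) ≡ + a * + b + + c * + d
  pos-linear₂ a b c d = trans (pos-+ (a ℕ.* b) (c ℕ.* d)) (cong₂ _+_ (pos-* a b) (pos-* c d))

  pos-linear₃ : ∀ a b c d e f →
                + (a ℕ.* b ℕ.+ c ℕ.* d ℕ.+ e ℕ.* f) ≡ + a * + b + + c * + d + + e * + f
  pos-linear₃ a b c d e f =
    trans (pos-+ (a ℕ.* b ℕ.+ c ℕ.* d) (e ℕ.* f)) (cong₂ _+_ (pos-linear₂ a b c d) (pos-* e f))

  identity₆ : ∀ N P l m {k S} →
              (∃₂ λ c d → k ≡ N + c × S ≡ + 1 + N + d
                        × N * N + P * c ≡ k * + 1 + l * N + m * d) →
              N * N + P * (k - N) ≡ k + l * N + m * (S - N - + 1)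
  identity₆ N P l m (c , d , refl , refl , H) = begin
    N * N + P * ((N + c) - N)                        ≡⟨ solve (N ∷ P ∷ c ∷ []) ⟩
    N * N + P * c                                    ≡⟨ H ⟩
    (N + c) * + 1 + l * N + m * d                    ≡⟨ solve (N ∷ c ∷ l ∷ m ∷ d ∷ []) ⟩
    N + c + l * N + m * ((+ 1 + N + d) - N - + 1)    ∎

  identity₇ : ∀ N P l m {k S} →
              (∃₂ λ c d → k ≡ P + c × S ≡ + 0 + P + d
                        × N * P + P * c ≡ k * + 0 + l * P + m * d) →
              N * P + P * (k - P) ≡ l * P + m * (S - P)
  identity₇ N P l m (c , d , refl , refl , H) = begin
    N * P + P * ((P + c) - P)          ≡⟨ solve (N ∷ P ∷ c ∷ []) ⟩
    N * P + P * c                      ≡⟨ H ⟩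
    (P + c) * + 0 + l * P + m * d      ≡⟨ solve (P ∷ c ∷ l ∷ m ∷ d ∷ []) ⟩
    l * P + m * ((+ 0 + P + d) - P)    ∎

  identity₈ : ∀ N P a l b {S k} →
              (∃₂ λ c d → S ≡ a + c × k ≡ + 1 + l + d
                        × N * a + P * c ≡ S * + 1 + a * l + b * d) →
              N * a + P * (S - a) ≡ S + a * l + b * (k - l - + 1)
  identity₈ N P a l b (c , d , refl , refl , H) = begin
    N * a + P * ((a + c) - a)                        ≡⟨ solve (N ∷ P ∷ a ∷ c ∷ []) ⟩
    N * a + P * c                                    ≡⟨ H ⟩
    (a + c) * + 1 + a * l + b * d                    ≡⟨ solve (a ∷ c ∷ l ∷ b ∷ d ∷ []) ⟩
    a + c + a * l + b * ((+ 1 + l + d) - l - + 1)    ∎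

  identity₉ : ∀ N P a m b {S k} →
              (∃₂ λ c d → S ≡ b + c × k ≡ + 0 + m + d
                        × N * b + P * c ≡ S * + 0 + a * m + b * d) →
              N * b + P * (S - b) ≡ a * m + b * (k - m)
  identity₉ N P a m b (c , d , refl , refl , H) = begin
    N * b + P * ((b + c) - b)          ≡⟨ solve (N ∷ P ∷ b ∷ c ∷ []) ⟩
    N * b + P * c                      ≡⟨ H ⟩
    (b + c) * + 0 + a * m + b * d      ≡⟨ solve (b ∷ c ∷ a ∷ m ∷ d ∷ []) ⟩
    a * m + b * ((+ 0 + m + d) - m)    ∎

  identity₁₀ : ∀ a₁ b₁ a₂ b₂ N₁ N₂ {S₁ S₂} →
               (∃₂ λ f g → S₂ ≡ + 1 + N₂ + f × S₁ ≡ + 1 + N₁ + g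
                         × S₁ * + 1 + a₁ * N₂ + b₁ * f ≡ S₂ * + 1 + a₂ * N₁ + b₂ * g) →
               S₁ + a₁ * N₂ + b₁ * (S₂ - N₂ - + 1) ≡ S₂ + a₂ * N₁ + b₂ * (S₁ - N₁ - + 1)
  identity₁₀ a₁ b₁ a₂ b₂ N₁ N₂ (f , g , refl , refl , H) = begin
    (+ 1 + N₁ + g) + a₁ * N₂ + b₁ * ((+ 1 + N₂ + f) - N₂ - + 1)
      ≡⟨ solve (a₁ ∷ b₁ ∷ N₁ ∷ N₂ ∷ f ∷ g ∷ []) ⟩
    (+ 1 + N₁ + g) * + 1 + a₁ * N₂ + b₁ * f
      ≡⟨ H ⟩
    (+ 1 + N₂ + f) * + 1 + a₂ * N₁ + b₂ * g
      ≡⟨ solve (a₂ ∷ b₂ ∷ N₁ ∷ N₂ ∷ f ∷ g ∷ []) ⟩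
    (+ 1 + N₂ + f) + a₂ * N₁ + b₂ * ((+ 1 + N₁ + g) - N₁ - + 1) ∎

  identity₁₁ : ∀ a₁ b₁ a₂ b₂ P₁ P₂ {S₁ S₂} →
               (∃₂ λ f g → S₂ ≡ + 0 + P₂ + f × S₁ ≡ + 0 + P₁ + g
                         × S₁ * + 0 + a₁ * P₂ + b₁ * f ≡ S₂ * + 0 + a₂ * P₁ + b₂ * g) →
               a₁ * P₂ + b₁ * (S₂ - P₂) ≡ a₂ * P₁ + b₂ * (S₁ - P₁)
  identity₁₁ a₁ b₁ a₂ b₂ P₁ P₂ (f , g , refl , refl , H) = begin
    a₁ * P₂ + b₁ * ((+ 0 + P₂ + f) - P₂)         ≡⟨ solve (a₁ ∷ b₁ ∷ P₁ ∷ P₂ ∷ f ∷ g ∷ []) ⟩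
    (+ 0 + P₁ + g) * + 0 + a₁ * P₂ + b₁ * f      ≡⟨ H ⟩
    (+ 0 + P₂ + f) * + 0 + a₂ * P₁ + b₂ * g      ≡⟨ solve (a₂ ∷ b₂ ∷ P₁ ∷ P₂ ∷ f ∷ g ∷ []) ⟩
    a₂ * P₁ + b₂ * ((+ 0 + P₁ + g) - P₁)         ∎

  identity₁₂ : ∀ N₁ N₂ P₁ P₂ {k₁ k₂} →
               (∃₂ λ c h → k₁ ≡ N₁ + c × k₂ ≡ N₂ + h
                         × N₂ * N₁ + P₂ * c ≡ N₁ * N₂ + P₁ * h) →
               P₁ * (k₂ - N₂) ≡ P₂ * (k₁ - N₁)
  identity₁₂ N₁ N₂ P₁ P₂ (c , h , refl , refl , H) = begin
    P₁ * ((N₂ + h) - N₂)                 ≡⟨ solve (N₁ ∷ N₂ ∷ P₁ ∷ h ∷ []) ⟩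
    (N₁ * N₂ + P₁ * h) - N₁ * N₂         ≡⟨ cong (_- N₁ * N₂) H ⟨
    (N₂ * N₁ + P₂ * c) - N₁ * N₂         ≡⟨ solve (N₁ ∷ N₂ ∷ P₂ ∷ c ∷ []) ⟩
    P₂ * ((N₁ + c) - N₁)                 ∎

open IntegerIdentities

module PathCounts
  {n₁ n₂ : ℕ} (E₁ : Fin n₁ → Fin n₁ → Bool) (E₂ : Fin n₂ → Fin n₂ → Bool)
  (R : Fin n₁ → Fin n₂ → Bool)
  (cc : IsCoherentConfiguration (elemsX n₁ n₂) idxs (σ E₁ E₂ R))
  (E₁-sym : ∀ x y → E₁ x y ≡ E₁ y x) (E₂-sym : ∀ z w → E₂ z w ≡ E₂ w z)
  (p : Params E₁ E₂ R) where

  open import Data.Nat.Base using (_+_; _*_)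
  open Params p
  open IsCoherentConfiguration cc using (nonempty)
  open ≡-Reasoning

  X₁ : List (Fin n₁)
  X₁ = allFin n₁

  X₂ : List (Fin n₂)
  X₂ = allFin n₂

  σ₂ σ₃ : Fin n₁ → Fin n₁ → Bool
  σ₂ x y = not (eqb x y) ∧ E₁ x y
  σ₃ x y = not (eqb x y) ∧ not (E₁ x y)

  σ₅ σ₆ : Fin n₂ → Fin n₂ → Bool
  σ₅ z w = not (eqb z w) ∧ E₂ z w
  σ₆ z w = not (eqb z w) ∧ not (E₂ z w)

  k₁-count : ∀ x → count (σ₂ x) X₁ ≡ k₁
  k₁-count x = trans (count-map _ inj₁ X₁) (k₁-def x)

  k₂-count : ∀ z → count (λ w → σ₅ w z) X₂ ≡ k₂
  k₂-count z = trans (count-cong (λ w → adjacency-sym E₂-sym w z) X₂)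
                     (trans (count-map _ inj₂ X₂) (k₂-def z))

  S₁-count : ∀ z → count (λ x → R x z) X₁ ≡ S₁
  S₁-count z = trans (count-map _ inj₁ X₁) (S₁-def z)

  S₂-count : ∀ x → count (R x) X₂ ≡ S₂
  S₂-count x = trans (count-map _ inj₂ X₂) (S₂-def x)

  σ₂σ₇-count : ∀ y z → count (λ v → σ₂ y v ∧ R v z) X₁ ≡ (if R y z then N₁ else P₁)
  σ₂σ₇-count y z with R y z in r
  ... | true  = trans (count-map _ inj₁ X₁) (N₁-def y z r)
  ... | false = trans (count-map _ inj₁ X₁) (P₁-def y z (cong not r))

  σ₇σ₅-count : ∀ y z → count (λ w → R y w ∧ σ₅ w z) X₂ ≡ (if R y z then N₂ else P₂)
  σ₇σ₅-count y z with R y z in r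
  ... | true  = trans (count-map _ inj₂ X₂) (N₂-def y z r)
  ... | false = trans (count-map _ inj₂ X₂) (P₂-def y z (cong not r))

  σ₂σ₂-count : ∀ x v → count (λ y → σ₂ x y ∧ σ₂ y v) X₁
                       ≡ (if eqb x v then k₁ else if E₁ x v then λ₁ else μ₁)
  σ₂σ₂-count = by-adjacency E₁
    (λ x → trans (count-cong (λ y → trans (cong (σ₂ x y ∧_) (adjacency-sym E₁-sym y x))
                                          (∧-idem (σ₂ x y))) X₁)
                 (k₁-count x))
    (λ x y h → trans (count-map _ inj₁ X₁) (λ₁-def x y h))
    (λ x y h → trans (count-map _ inj₁ X₁) (μ₁-def x y h))

  σ₇σ₉-count : ∀ x y → count (λ z → R x z ∧ R y z) X₂
                       ≡ (if eqb x y then S₂ else if E₁ x y then a₂ else b₂)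
  σ₇σ₉-count = by-adjacency E₁
    (λ x → trans (count-cong (λ z → ∧-idem (R x z)) X₂) (S₂-count x))
    (λ x y h → trans (count-map _ inj₂ X₂) (a₂-def x y h))
    (λ x y h → trans (count-map _ inj₂ X₂) (b₂-def x y h))

  σ₉σ₇-count : ∀ z w → count (λ x → R x z ∧ R x w) X₁
                       ≡ (if eqb z w then S₁ else if E₂ z w then a₁ else b₁)
  σ₉σ₇-count = by-adjacency E₂
    (λ z → trans (count-cong (λ x → ∧-idem (R x z)) X₁) (S₁-count z))
    (λ z w h → trans (count-map _ inj₁ X₁) (a₁-def z w h))
    (λ z w h → trans (count-map _ inj₁ X₁) (b₁-def z w h))

  -- The case is passed as R x z ≡ b so that n and e compute once b is a literal.
  σ₂σ₂σ₇-paths : ∀ {x z b} → R x z ≡ b →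
    let n = if b then N₁ else P₁
        e = ⟦ b ⟧· 1
    in ∃₂ λ c d → + k₁ ≡ + n ℤ.+ c
                × + S₁ ≡ + e ℤ.+ + n ℤ.+ d
                × + N₁ ℤ.* + n ℤ.+ + P₁ ℤ.* c ≡ + k₁ ℤ.* + e ℤ.+ + λ₁ ℤ.* + n ℤ.+ + μ₁ ℤ.* d
  σ₂σ₂σ₇-paths {x} {z} refl =
      + c , + d
    , lift-≡ refl (pos-+ n c) k₁-split
    , lift-≡ refl (pos-+₃ e n d) S₁-split
    , lift-≡ (pos-linear₂ N₁ n P₁ c) (pos-linear₃ k₁ e λ₁ n μ₁ d) paths
    where
    n e c d : ℕ
    n = if R x z then N₁ else P₁
    e = ⟦ R x z ⟧· 1
    c = count (λ y → σ₂ x y ∧ not (R y z)) X₁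
    d = count (λ v → R v z ∧ σ₃ x v) X₁

    n-count : count (λ v → R v z ∧ σ₂ x v) X₁ ≡ n
    n-count = trans (count-∧-comm (λ v → R v z) (σ₂ x) X₁) (σ₂σ₇-count x z)

    e-count : count (λ v → R v z ∧ eqb x v) X₁ ≡ e
    e-count = count-at (λ v → R v z) x

    k₁-split : k₁ ≡ n + c
    k₁-split = begin
      k₁                                     ≡⟨ k₁-count x ⟨
      count (σ₂ x) X₁                        ≡⟨ count-split (σ₂ x) (λ y → R y z) X₁ ⟩
      count (λ y → σ₂ x y ∧ R y z) X₁ + c    ≡⟨ cong (_+ c) (σ₂σ₇-count x z) ⟩
      n + c                                  ∎

    S₁-split : S₁ ≡ e + n + d
    S₁-split = begin
      S₁                                     ≡⟨ S₁-count z ⟨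
      count (λ v → R v z) X₁                 ≡⟨ count-split₃ (λ v → R v z) (eqb x) (E₁ x) X₁ ⟩
      count (λ v → R v z ∧ eqb x v) X₁ + count (λ v → R v z ∧ σ₂ x v) X₁ + d
                                             ≡⟨ cong₂ (λ s t → s + t + d) e-count n-count ⟩
      e + n + d                              ∎

    paths : N₁ * n + P₁ * c ≡ k₁ * e + λ₁ * n + μ₁ * d
    paths = begin
      N₁ * n + P₁ * c
        ≡⟨ cong (λ t → N₁ * t + P₁ * c) (σ₂σ₇-count x z) ⟨
      N₁ * count (λ y → σ₂ x y ∧ R y z) X₁ + P₁ * c
        ≡⟨ ∑-guarded₂ (σ₂ x) (λ y → R y z) N₁ P₁ X₁ ⟨
      ∑ (λ y → ⟦ σ₂ x y ⟧· (if R y z then N₁ else P₁)) X₁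
        ≡⟨ count-paths (σ₂ x) (λ v → R v z) X₁ X₁ (λ y → σ₂σ₇-count y z) (σ₂σ₂-count x) ⟩
      ∑ (λ v → ⟦ R v z ⟧· (if eqb x v then k₁ else if E₁ x v then λ₁ else μ₁)) X₁
        ≡⟨ ∑-guarded₃ (λ v → R v z) (eqb x) (E₁ x) k₁ λ₁ μ₁ X₁ ⟩
      k₁ * count (λ v → R v z ∧ eqb x v) X₁ + λ₁ * count (λ v → R v z ∧ σ₂ x v) X₁ + μ₁ * d
        ≡⟨ cong₂ (λ s t → k₁ * s + λ₁ * t + μ₁ * d) e-count n-count ⟩
      k₁ * e + λ₁ * n + μ₁ * d ∎

  σ₂σ₇σ₉-paths : ∀ {x y b} → eqb x y ≡ false → E₁ x y ≡ b →
    let n = if b then a₂ else b₂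
        l = if b then λ₁ else μ₁
        e = ⟦ b ⟧· 1
    in ∃₂ λ c d → + S₂ ≡ + n ℤ.+ c
                × + k₁ ≡ + e ℤ.+ + l ℤ.+ d
                × + N₁ ℤ.* + n ℤ.+ + P₁ ℤ.* c ≡ + S₂ ℤ.* + e ℤ.+ + a₂ ℤ.* + l ℤ.+ + b₂ ℤ.* d
  σ₂σ₇σ₉-paths {x} {y} x≢y refl =
      + c , + d
    , lift-≡ refl (pos-+ n c) S₂-split
    , lift-≡ refl (pos-+₃ e l d) k₁-split
    , lift-≡ (pos-linear₂ N₁ n P₁ c) (pos-linear₃ S₂ e a₂ l b₂ d) paths
    where
    n l e c d : ℕ
    n = if E₁ x y then a₂ else b₂
    l = if E₁ x y then λ₁ else μ₁
    e = ⟦ E₁ x y ⟧· 1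
    c = count (λ z → R y z ∧ not (R x z)) X₂
    d = count (λ v → σ₂ x v ∧ σ₃ v y) X₁

    off-diagonal : ∀ {α β : ℕ} → (if eqb x y then α else β) ≡ β
    off-diagonal {α} {β} = cong (λ t → if t then α else β) x≢y

    n-count : count (λ z → R y z ∧ R x z) X₂ ≡ n
    n-count = trans (count-∧-comm (R y) (R x) X₂) (trans (σ₇σ₉-count x y) off-diagonal)

    l-count : count (λ v → σ₂ x v ∧ σ₂ v y) X₁ ≡ l
    l-count = trans (σ₂σ₂-count x y) off-diagonal

    e-count : count (λ v → σ₂ x v ∧ eqb v y) X₁ ≡ e
    e-count = trans (count-at′ (σ₂ x) y) (cong (λ t → ⟦ not t ∧ E₁ x y ⟧· 1) x≢y)

    S₂-split : S₂ ≡ n + c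
    S₂-split = begin
      S₂                                     ≡⟨ S₂-count y ⟨
      count (R y) X₂                         ≡⟨ count-split (R y) (R x) X₂ ⟩
      count (λ z → R y z ∧ R x z) X₂ + c     ≡⟨ cong (_+ c) n-count ⟩
      n + c                                  ∎

    k₁-split : k₁ ≡ e + l + d
    k₁-split = begin
      k₁                                     ≡⟨ k₁-count x ⟨
      count (σ₂ x) X₁                        ≡⟨ count-split₃ (σ₂ x) (λ v → eqb v y) (λ v → E₁ v y) X₁ ⟩
      count (λ v → σ₂ x v ∧ eqb v y) X₁ + count (λ v → σ₂ x v ∧ σ₂ v y) X₁ + d
                                             ≡⟨ cong₂ (λ s t → s + t + d) e-count l-count ⟩
      e + l + d                              ∎

    paths : N₁ * n + P₁ * c ≡ S₂ * e + a₂ * l + b₂ * d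
    paths = begin
      N₁ * n + P₁ * c
        ≡⟨ cong (λ t → N₁ * t + P₁ * c) n-count ⟨
      N₁ * count (λ z → R y z ∧ R x z) X₂ + P₁ * c
        ≡⟨ ∑-guarded₂ (R y) (R x) N₁ P₁ X₂ ⟨
      ∑ (λ z → ⟦ R y z ⟧· (if R x z then N₁ else P₁)) X₂
        ≡⟨ count-paths (σ₂ x) (R y) X₁ X₂ (λ v → σ₇σ₉-count v y) (σ₂σ₇-count x) ⟨
      ∑ (λ v → ⟦ σ₂ x v ⟧· (if eqb v y then S₂ else if E₁ v y then a₂ else b₂)) X₁
        ≡⟨ ∑-guarded₃ (σ₂ x) (λ v → eqb v y) (λ v → E₁ v y) S₂ a₂ b₂ X₁ ⟩
      S₂ * count (λ v → σ₂ x v ∧ eqb v y) X₁ + a₂ * count (λ v → σ₂ x v ∧ σ₂ v y) X₁ + b₂ * d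
        ≡⟨ cong₂ (λ s t → S₂ * s + a₂ * t + b₂ * d) e-count l-count ⟩
      S₂ * e + a₂ * l + b₂ * d ∎

  σ₇σ₉σ₇-paths : ∀ {x z b} → R x z ≡ b →
    let m₁ = if b then N₁ else P₁
        m₂ = if b then N₂ else P₂
        e  = ⟦ b ⟧· 1
    in ∃₂ λ f g → + S₂ ≡ + e ℤ.+ + m₂ ℤ.+ f
                × + S₁ ≡ + e ℤ.+ + m₁ ℤ.+ g
                × + S₁ ℤ.* + e ℤ.+ + a₁ ℤ.* + m₂ ℤ.+ + b₁ ℤ.* f
                  ≡ + S₂ ℤ.* + e ℤ.+ + a₂ ℤ.* + m₁ ℤ.+ + b₂ ℤ.* g
  σ₇σ₉σ₇-paths {x} {z} refl =
      + f , + g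
    , lift-≡ refl (pos-+₃ e m₂ f) S₂-split
    , lift-≡ refl (pos-+₃ e m₁ g) S₁-split
    , lift-≡ (pos-linear₃ S₁ e a₁ m₂ b₁ f) (pos-linear₃ S₂ e a₂ m₁ b₂ g) paths
    where
    m₁ m₂ e f g : ℕ
    m₁ = if R x z then N₁ else P₁
    m₂ = if R x z then N₂ else P₂
    e  = ⟦ R x z ⟧· 1
    f  = count (λ w → R x w ∧ σ₆ w z) X₂
    g  = count (λ y → R y z ∧ σ₃ x y) X₁

    e-count₂ : count (λ w → R x w ∧ eqb w z) X₂ ≡ e
    e-count₂ = count-at′ (R x) z

    e-count₁ : count (λ y → R y z ∧ eqb x y) X₁ ≡ e
    e-count₁ = count-at (λ y → R y z) x

    m₁-count : count (λ y → R y z ∧ σ₂ x y) X₁ ≡ m₁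
    m₁-count = trans (count-∧-comm (λ y → R y z) (σ₂ x) X₁) (σ₂σ₇-count x z)

    S₂-split : S₂ ≡ e + m₂ + f
    S₂-split = begin
      S₂                                     ≡⟨ S₂-count x ⟨
      count (R x) X₂                         ≡⟨ count-split₃ (R x) (λ w → eqb w z) (λ w → E₂ w z) X₂ ⟩
      count (λ w → R x w ∧ eqb w z) X₂ + count (λ w → R x w ∧ σ₅ w z) X₂ + f
                                             ≡⟨ cong₂ (λ s t → s + t + f) e-count₂ (σ₇σ₅-count x z) ⟩
      e + m₂ + f                             ∎

    S₁-split : S₁ ≡ e + m₁ + g
    S₁-split = begin
      S₁                                     ≡⟨ S₁-count z ⟨
      count (λ y → R y z) X₁                 ≡⟨ count-split₃ (λ y → R y z) (eqb x) (E₁ x) X₁ ⟩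
      count (λ y → R y z ∧ eqb x y) X₁ + count (λ y → R y z ∧ σ₂ x y) X₁ + g
                                             ≡⟨ cong₂ (λ s t → s + t + g) e-count₁ m₁-count ⟩
      e + m₁ + g                             ∎

    paths : S₁ * e + a₁ * m₂ + b₁ * f ≡ S₂ * e + a₂ * m₁ + b₂ * g
    paths = begin
      S₁ * e + a₁ * m₂ + b₁ * f
        ≡⟨ cong₂ (λ s t → S₁ * s + a₁ * t + b₁ * f) e-count₂ (σ₇σ₅-count x z) ⟨
      S₁ * count (λ w → R x w ∧ eqb w z) X₂ + a₁ * count (λ w → R x w ∧ σ₅ w z) X₂ + b₁ * f
        ≡⟨ ∑-guarded₃ (R x) (λ w → eqb w z) (λ w → E₂ w z) S₁ a₁ b₁ X₂ ⟨
      ∑ (λ w → ⟦ R x w ⟧· (if eqb w z then S₁ else if E₂ w z then a₁ else b₁)) X₂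
        ≡⟨ count-paths (R x) (λ y → R y z) X₂ X₁ (λ w → σ₉σ₇-count w z) (σ₇σ₉-count x) ⟩
      ∑ (λ y → ⟦ R y z ⟧· (if eqb x y then S₂ else if E₁ x y then a₂ else b₂)) X₁
        ≡⟨ ∑-guarded₃ (λ y → R y z) (eqb x) (E₁ x) S₂ a₂ b₂ X₁ ⟩
      S₂ * count (λ y → R y z ∧ eqb x y) X₁ + a₂ * count (λ y → R y z ∧ σ₂ x y) X₁ + b₂ * g
        ≡⟨ cong₂ (λ s t → S₂ * s + a₂ * t + b₂ * g) e-count₁ m₁-count ⟩
      S₂ * e + a₂ * m₁ + b₂ * g ∎

  σ₂σ₇σ₅-paths : ∀ {x z b} → R x z ≡ b →
    let m₁ = if b then N₁ else P₁
        m₂ = if b then N₂ else P₂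
    in ∃₂ λ c h → + k₁ ≡ + m₁ ℤ.+ c
                × + k₂ ≡ + m₂ ℤ.+ h
                × + N₂ ℤ.* + m₁ ℤ.+ + P₂ ℤ.* c ≡ + N₁ ℤ.* + m₂ ℤ.+ + P₁ ℤ.* h
  σ₂σ₇σ₅-paths {x} {z} refl =
      + c , + h
    , lift-≡ refl (pos-+ m₁ c) k₁-split
    , lift-≡ refl (pos-+ m₂ h) k₂-split
    , lift-≡ (pos-linear₂ N₂ m₁ P₂ c) (pos-linear₂ N₁ m₂ P₁ h) paths
    where
    m₁ m₂ c h : ℕ
    m₁ = if R x z then N₁ else P₁
    m₂ = if R x z then N₂ else P₂
    c  = count (λ y → σ₂ x y ∧ not (R y z)) X₁
    h  = count (λ w → σ₅ w z ∧ not (R x w)) X₂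

    m₂-count : count (λ w → σ₅ w z ∧ R x w) X₂ ≡ m₂
    m₂-count = trans (count-∧-comm (λ w → σ₅ w z) (R x) X₂) (σ₇σ₅-count x z)

    k₁-split : k₁ ≡ m₁ + c
    k₁-split = begin
      k₁                                     ≡⟨ k₁-count x ⟨
      count (σ₂ x) X₁                        ≡⟨ count-split (σ₂ x) (λ y → R y z) X₁ ⟩
      count (λ y → σ₂ x y ∧ R y z) X₁ + c    ≡⟨ cong (_+ c) (σ₂σ₇-count x z) ⟩
      m₁ + c                                 ∎

    k₂-split : k₂ ≡ m₂ + h
    k₂-split = begin
      k₂                                     ≡⟨ k₂-count z ⟨
      count (λ w → σ₅ w z) X₂                ≡⟨ count-split (λ w → σ₅ w z) (R x) X₂ ⟩
      count (λ w → σ₅ w z ∧ R x w) X₂ + h    ≡⟨ cong (_+ h) m₂-count ⟩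
      m₂ + h                                 ∎

    paths : N₂ * m₁ + P₂ * c ≡ N₁ * m₂ + P₁ * h
    paths = begin
      N₂ * m₁ + P₂ * c
        ≡⟨ cong (λ t → N₂ * t + P₂ * c) (σ₂σ₇-count x z) ⟨
      N₂ * count (λ y → σ₂ x y ∧ R y z) X₁ + P₂ * c
        ≡⟨ ∑-guarded₂ (σ₂ x) (λ y → R y z) N₂ P₂ X₁ ⟨
      ∑ (λ y → ⟦ σ₂ x y ⟧· (if R y z then N₂ else P₂)) X₁
        ≡⟨ count-paths (σ₂ x) (λ w → σ₅ w z) X₁ X₂ (λ y → σ₇σ₅-count y z) (σ₂σ₇-count x) ⟩
      ∑ (λ w → ⟦ σ₅ w z ⟧· (if R x w then N₁ else P₁)) X₂
        ≡⟨ ∑-guarded₂ (λ w → σ₅ w z) (R x) N₁ P₁ X₂ ⟩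
      N₁ * count (λ w → σ₅ w z ∧ R x w) X₂ + P₁ * h
        ≡⟨ cong (λ t → N₁ * t + P₁ * h) m₂-count ⟩
      N₁ * m₂ + P₁ * h ∎

  σ₇-witness : Σ (Fin n₁) λ x → Σ (Fin n₂) λ z → R x z ≡ true
  σ₇-witness with nonempty s7
  ... | inj₁ x , inj₂ z , r = x , z , r
  ... | inj₁ _ , inj₁ _ , ()
  ... | inj₂ _ , _      , ()

  σ₈-witness : Σ (Fin n₁) λ x → Σ (Fin n₂) λ z → R x z ≡ false
  σ₈-witness with nonempty s8
  ... | inj₁ x , inj₂ z , r = x , z , not-injective {y = false} r
  ... | inj₁ _ , inj₁ _ , ()
  ... | inj₂ _ , _      , ()

  σ₂-witness : Σ (Fin n₁) λ x → Σ (Fin n₁) λ y → eqb x y ≡ false × E₁ x y ≡ true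
  σ₂-witness with nonempty s2
  ... | inj₁ x , inj₁ y , h =
    x , y , not-injective {y = false} (∧-conicalˡ _ _ h) , ∧-conicalʳ _ _ h
  ... | inj₁ _ , inj₂ _ , ()
  ... | inj₂ _ , _      , ()

  σ₃-witness : Σ (Fin n₁) λ x → Σ (Fin n₁) λ y → eqb x y ≡ false × E₁ x y ≡ false
  σ₃-witness with nonempty s3
  ... | inj₁ x , inj₁ y , h =
    x , y , not-injective {y = false} (∧-conicalˡ _ _ h) , not-injective {y = false} (∧-conicalʳ _ _ h)
  ... | inj₁ _ , inj₂ _ , ()
  ... | inj₂ _ , _      , ()

mainTheorem3 : (n₁ n₂ : ℕ) (E₁ : Fin n₁ → Fin n₁ → Bool) (E₂ : Fin n₂ → Fin n₂ → Bool)
    (R : Fin n₁ → Fin n₂ → Bool) →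
    IsCoherentConfiguration (elemsX n₁ n₂) idxs (σ E₁ E₂ R) →
    (∀ x y → E₁ x y ≡ E₁ y x) → (∀ z w → E₂ z w ≡ E₂ w z) →
    (p : Params E₁ E₂ R) → Identities p
mainTheorem3 n₁ n₂ E₁ E₂ R cc E₁-sym E₂-sym p =
  let _ , _ , r₇ = σ₇-witness
      _ , _ , r₈ = σ₈-witness
      _ , _ , x≢y , edge = σ₂-witness
      _ , _ , x′≢y′ , non-edge = σ₃-witness
  in identity₆  (+ N₁) (+ P₁) (+ λ₁) (+ μ₁) (σ₂σ₂σ₇-paths r₇)
   , identity₇  (+ N₁) (+ P₁) (+ λ₁) (+ μ₁) (σ₂σ₂σ₇-paths r₈)
   , identity₈  (+ N₁) (+ P₁) (+ a₂) (+ λ₁) (+ b₂) (σ₂σ₇σ₉-paths x≢y edge)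
   , identity₉  (+ N₁) (+ P₁) (+ a₂) (+ μ₁) (+ b₂) (σ₂σ₇σ₉-paths x′≢y′ non-edge)
   , identity₁₀ (+ a₁) (+ b₁) (+ a₂) (+ b₂) (+ N₁) (+ N₂) (σ₇σ₉σ₇-paths r₇)
   , identity₁₁ (+ a₁) (+ b₁) (+ a₂) (+ b₂) (+ P₁) (+ P₂) (σ₇σ₉σ₇-paths r₈)
   , identity₁₂ (+ N₁) (+ N₂) (+ P₁) (+ P₂) (σ₂σ₇σ₅-paths r₇)
  where
  open Params p
  open PathCounts E₁ E₂ R cc E₁-sym E₂-sym p
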